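{- Let $K\subset F$ be a field extension and let $A$ and $B$ be $n$-dimensional $K$-subspaces of $F$ with $n>1$. If $A$ is matched to $B$, then $\langle AB\rangle\neq A$.
   Context: $\langle AB\rangle$ denotes the $K$-subspace of $F$ spanned by $AB=\{ab: a\in A, b\in B\}$. An ordered basis $\{a_1,\dots,a_n\}$ of $A$ is matched to an ordered basis $\{b_1,\dots,b_n\}$ of $B$ if $a_i^{ -1}A\cap B\subseteq\langle b_1,\dots,\hat b_i,\dots,b_n\rangle$ (the $K$-span of $\{b_j:j\ne i\}$) for each $i$. $A$ is matched to $B$ if every basis of $A$ can be matched to some basis of $B$. -}

module Defs where

open import Level using (Level; _⊔_) renaming (suc to lsuc)
open import Data.Nat using (ℕ)
import Data.Nat as ℕ
open import Data.Fin using (Fin)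
import Data.Fin as Fin
open import Data.Product using (Σ; ∃; _×_; _,_)
open import Relation.Nullary using (¬_)
open import Relation.Binary.PropositionalEquality using (_≡_)
open import Algebra.Bundles using (CommutativeRing)
open import Function.Bundles using (_⇔_)

record Field (c ℓ : Level) : Set (lsuc (c ⊔ ℓ)) where
  field
    commutativeRing : CommutativeRing c ℓ
  open CommutativeRing commutativeRing public
  field
    0≉1     : ¬ (0# ≈ 1#)
    inverse : ∀ x → ¬ (x ≈ 0#) → ∃ λ y → x * y ≈ 1#

module _ {c ℓ : Level} (F : Field c ℓ) where
  open Field F hiding (zero)

  ∑ : (n : ℕ) → (Fin n → Carrier) → Carrier
  ∑ ℕ.zero    f = 0#
  ∑ (ℕ.suc n) f = f Fin.zero + ∑ n (λ i → f (Fin.suc i))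

  record Subfield {k} (K : Carrier → Set k) : Set (c ⊔ ℓ ⊔ k) where
    field
      resp  : ∀ {x y} → x ≈ y → K x → K y
      zero∈ : K 0#
      one∈  : K 1#
      +∈    : ∀ {x y} → K x → K y → K (x + y)
      neg∈  : ∀ {x} → K x → K (- x)
      *∈    : ∀ {x y} → K x → K y → K (x * y)
      inv∈  : ∀ {x y} → K x → x * y ≈ 1# → K y

  module _ {k} (K : Carrier → Set k) where

    InSpan : {m : ℕ} → (Fin m → Carrier) → Carrier → Set (c ⊔ ℓ ⊔ k)
    InSpan {m} v x = Σ (Fin m → Carrier) λ γ →
      (∀ j → K (γ j)) × (x ≈ ∑ m (λ j → γ j * v j))

    InSpanExcept : {m : ℕ} → (Fin m → Carrier) → Fin m → Carrier → Set (c ⊔ ℓ ⊔ k)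
    InSpanExcept {m} v i x = Σ (Fin m → Carrier) λ γ →
      (∀ j → K (γ j)) × (γ i ≈ 0#) × (x ≈ ∑ m (λ j → γ j * v j))

    record Subspace {a} (A : Carrier → Set a) : Set (c ⊔ ℓ ⊔ k ⊔ a) where
      field
        resp  : ∀ {x y} → x ≈ y → A x → A y
        zero∈ : A 0#
        +∈    : ∀ {x y} → A x → A y → A (x + y)
        smul∈ : ∀ {λ' x} → K λ' → A x → A (λ' * x)

    LinIndep : {m : ℕ} → (Fin m → Carrier) → Set (c ⊔ ℓ ⊔ k)
    LinIndep {m} v = ∀ (γ : Fin m → Carrier) → (∀ j → K (γ j)) →
      ∑ m (λ j → γ j * v j) ≈ 0# → ∀ j → γ j ≈ 0#

    record IsBasis {a} {m : ℕ} (A : Carrier → Set a) (v : Fin m → Carrier)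
           : Set (c ⊔ ℓ ⊔ k ⊔ a) where
      field
        mem     : ∀ j → A (v j)
        indep   : LinIndep v
        spans   : ∀ x → A x → InSpan v x

    HasDim : ∀ {a} → (Carrier → Set a) → ℕ → Set (c ⊔ ℓ ⊔ k ⊔ a)
    HasDim A n = Σ (Fin n → Carrier) λ v → IsBasis A v

    ProdSpan : ∀ {a b} → (Carrier → Set a) → (Carrier → Set b) →
               Carrier → Set (c ⊔ ℓ ⊔ k ⊔ a ⊔ b)
    ProdSpan A B x = Σ ℕ λ m → Σ (Fin m → Carrier) λ α → Σ (Fin m → Carrier) λ β →
      (∀ j → A (α j)) × (∀ j → B (β j)) × InSpan (λ j → α j * β j) x

    -- the ordered basis a of A is matched to the ordered basis b of B:
    -- a_i⁻¹ A ∩ B ⊆ ⟨b_1,…,b̂_i,…,b_n⟩ for each i.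
    -- (y ∈ a_i⁻¹ A  ⇔  a_i * y ∈ A, as a_i ≠ 0.)
    BasisMatched : ∀ {a b} {n : ℕ} → (Carrier → Set a) → (Carrier → Set b) →
                   (Fin n → Carrier) → (Fin n → Carrier) → Set (c ⊔ ℓ ⊔ k ⊔ a ⊔ b)
    BasisMatched A B α β = ∀ i y → A (α i * y) → B y → InSpanExcept β i y

    Matched : ∀ {a b} → ℕ → (Carrier → Set a) → (Carrier → Set b) →
              Set (c ⊔ ℓ ⊔ k ⊔ a ⊔ b)
    Matched n A B = ∀ (α : Fin n → Carrier) → IsBasis A α →
      Σ (Fin n → Carrier) λ β → IsBasis B β × BasisMatched A B α β

    SameSet : ∀ {a b} → (Carrier → Set a) → (Carrier → Set b) → Set (c ⊔ a ⊔ b)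
    SameSet A B = ∀ x → A x ⇔ B x

{-# OPTIONS --safe #-}
module Submission where

-- If ⟨AB⟩ = A, take any basis a of A and a basis b of B matched to it. Then a₁b₁ ∈ A,
-- so b₁ ∈ a₁⁻¹A ∩ B lies in the span of b₂,…,bₙ, contradicting the independence of b.

open import Defs
open import Level using (Level)
open import Data.Nat using (ℕ; zero; suc; _>_; s≤s)
open import Data.Fin using (Fin; _≟_; punchIn)
open import Data.Fin.Properties using (punchInᵢ≢i)
open import Data.Product using (_,_; proj₁; proj₂)
open import Data.Vec.Functional using (updateAt; removeAt)
open import Data.Vec.Functional.Properties using (updateAt-updates; updateAt-minimal)
open import Function using (_∘_; Equivalence)
open import Relation.Nullary using (¬_; yes; no)
open import Relation.Binary.PropositionalEquality as ≡ using (_≡_)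
import Algebra.Properties.Ring as RingProperties
import Algebra.Properties.Semiring.Sum as SemiringSum
import Relation.Binary.Reasoning.Setoid as SetoidReasoning

module _ {c ℓ k : Level} (F : Field c ℓ) {K : Field.Carrier F → Set k} (K-subfield : Subfield F K) where
  open Field F hiding (zero)
  open Subfield K-subfield
  open RingProperties ring using (-1*x≈-x)
  open SemiringSum semiring using (sum; sum-remove; sum-cong-≗)
  open SetoidReasoning setoid

  ∑≡sum : ∀ n (f : Fin n → Carrier) → ∑ F n f ≡ sum f
  ∑≡sum zero    f = ≡.refl
  ∑≡sum (suc n) f = ≡.cong (f Fin.zero +_) (∑≡sum n (f ∘ Fin.suc))

  -1≉0 : ¬ (- 1# ≈ 0#)
  -1≉0 -1≈0 = 0≉1 (sym (begin
    1#        ≈⟨ +-identityʳ 1# ⟨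
    1# + 0#   ≈⟨ +-congˡ -1≈0 ⟨
    1# + - 1# ≈⟨ -‿inverseʳ 1# ⟩
    0#        ∎))

  LinIndep⇒∉InSpanExcept : ∀ {n} {β : Fin n → Carrier} → LinIndep F K β →
                           ∀ i → ¬ InSpanExcept F K β i (β i)
  LinIndep⇒∉InSpanExcept {suc n} {β} indep i (γ , γ∈K , γᵢ≈0 , βᵢ≈∑) =
    -1≉0 (trans (reflexive (≡.sym (updateAt-updates i γ))) (indep γ′ γ′∈K ∑γ′β≈0 i))
    where
    γ′ : Fin (suc n) → Carrier
    γ′ = updateAt γ i (λ _ → - 1#)

    γ′∈K : ∀ j → K (γ′ j)
    γ′∈K j with j ≟ i
    ... | yes ≡.refl = resp (reflexive (≡.sym (updateAt-updates i γ))) (neg∈ one∈)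
    ... | no j≢i     = resp (reflexive (≡.sym (updateAt-minimal j i γ j≢i))) (γ∈K j)

    others : (Fin (suc n) → Carrier) → Carrier
    others δ = sum (removeAt (λ j → δ j * β j) i)

    others-γ′ : others γ′ ≈ others γ
    others-γ′ = reflexive (sum-cong-≗ λ j →
      ≡.cong (_* β (punchIn i j)) (updateAt-minimal (punchIn i j) i γ (punchInᵢ≢i i j)))

    expand : ∀ δ → ∑ F (suc n) (λ j → δ j * β j) ≈ δ i * β i + others δ
    expand δ = trans (reflexive (∑≡sum (suc n) δβ)) (sum-remove {i = i} δβ)
      where δβ = λ j → δ j * β j

    βᵢ≈others : β i ≈ others γ
    βᵢ≈others = begin
      β i                    ≈⟨ βᵢ≈∑ ⟩
      _                      ≈⟨ expand γ ⟩
      γ i * β i + others γ   ≈⟨ +-congʳ (trans (*-congʳ γᵢ≈0) (zeroˡ (β i))) ⟩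
      0# + others γ          ≈⟨ +-identityˡ (others γ) ⟩
      others γ               ∎

    ∑γ′β≈0 : ∑ F (suc n) (λ j → γ′ j * β j) ≈ 0#
    ∑γ′β≈0 = begin
      _                        ≈⟨ expand γ′ ⟩
      γ′ i * β i + others γ′   ≈⟨ +-cong (*-congʳ (reflexive (updateAt-updates i γ))) others-γ′ ⟩
      - 1# * β i + others γ    ≈⟨ +-cong (-1*x≈-x (β i)) (sym βᵢ≈others) ⟩
      - β i + β i              ≈⟨ -‿inverseˡ (β i) ⟩
      0#                       ∎

  module _ {a b : Level} {A : Carrier → Set a} {B : Carrier → Set b} where

    product∈ProdSpan : ∀ {x y} → A x → B y → ProdSpan F K A B (x * y)
    product∈ProdSpan {x} {y} x∈A y∈B =
      1 , (λ _ → x) , (λ _ → y) , (λ _ → x∈A) , (λ _ → y∈B) ,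
      (λ _ → 1#) , (λ _ → one∈) , sym (trans (+-identityʳ _) (*-identityˡ _))

    BasisMatched⇒product∉ : ∀ {n} {α β : Fin n → Carrier} →
                            BasisMatched F K A B α β → IsBasis F K B β →
                            ∀ i → ¬ A (α i * β i)
    BasisMatched⇒product∉ matched β-basis i αᵢβᵢ∈A =
      LinIndep⇒∉InSpanExcept (IsBasis.indep β-basis) i
        (matched i _ αᵢβᵢ∈A (IsBasis.mem β-basis i))

theorem1p4 : ∀ {c ℓ k a b : Level} (F : Field c ℓ) (K : Field.Carrier F → Set k) →
    Subfield F K → (n : ℕ) → n > 1 →
    (A : Field.Carrier F → Set a) (B : Field.Carrier F → Set b) →
    Subspace F K A → Subspace F K B → HasDim F K A n → HasDim F K B n →
    Matched F K n A B →
    ¬ SameSet F K (ProdSpan F K A B) A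
theorem1p4 F K K-subfield (suc n) (s≤s _) A B _ _ (α , α-basis) _ matched AB≡A =
  BasisMatched⇒product∉ F K-subfield {A = A} α-matched β-basis Fin.zero αβ∈A
  where
  β = proj₁ (matched α α-basis)
  β-basis = proj₁ (proj₂ (matched α α-basis))
  α-matched = proj₂ (proj₂ (matched α α-basis))
  αβ∈A = Equivalence.to (AB≡A _)
    (product∈ProdSpan F K-subfield {A = A} {B = B} (IsBasis.mem α-basis Fin.zero) (IsBasis.mem β-basis Fin.zero))
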